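{- Let $n\ge 2$ and let $H=(V,E)$ be an $n$-uniform hypergraph. For $v\in V$ let $d_v$ be the degree of $v$ (the number of edges containing $v$), and for $I\subseteq V$ let $d(I)=\sum_{v\in I} d_v$. Then there is an independent set $I\subseteq V$ such that \[ d(I)\ge \frac{n-1}{n}\sum_{v\in V,\ d_v>0} d_v^{\frac{n-2}{n-1}}. \]
   Context: A hypergraph $H=(V,E)$ consists of a finite vertex set $V$ and a family $E$ of subsets of $V$ (edges); it is $n$-uniform if every edge has exactly $n$ elements. A set $I\subseteq V$ is independent if it contains no edge of $H$. -}

module Defs where

open import Data.Nat using (ℕ; _+_; _<_)
open import Data.Nat.Properties using (_<?_)
open import Data.Fin using (Fin)
open import Data.Fin.Subset using (Subset; _∈_; _⊆_; ∣_∣)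
open import Data.Fin.Subset.Properties using (_∈?_)
open import Data.List using (List; length; filter; allFin; map)
open import Data.Nat.ListAction using (sum)
open import Data.List.Membership.Propositional using () renaming (_∈_ to _∈ₗ_)
open import Data.List.Relation.Unary.All using (All)
open import Data.List.Relation.Unary.Unique.Propositional using (Unique)
open import Relation.Binary.PropositionalEquality using (_≡_)
open import Relation.Nullary using (¬_)

record Hypergraph (m : ℕ) : Set where
  field
    edges  : List (Subset m)
    simple : Unique edges
open Hypergraph public

Uniform : {m : ℕ} → ℕ → Hypergraph m → Set
Uniform n H = All (λ e → ∣ e ∣ ≡ n) (edges H)

degree : {m : ℕ} → Hypergraph m → Fin m → ℕ
degree H v = length (filter (v ∈?_) (edges H))

Independent : {m : ℕ} → Hypergraph m → Subset m → Set
Independent H I = ∀ e → e ∈ₗ edges H → ¬ (e ⊆ I)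

degSum : {m : ℕ} → Hypergraph m → Subset m → ℕ
degSum {m} H I = sum (map (degree H) (filter (_∈? I) (allFin m)))

sumPos : {m : ℕ} → Hypergraph m → (Fin m → ℕ) → ℕ
sumPos {m} H f = sum (map f (filter (λ v → 0 <? degree H v) (allFin m)))

-- Write p = n − 1 and f(d) = ∏_{i=1}^{d} p i / (p i + 1), so that f(d − 1) − f(d) = f(d) / (p d)
-- and f is convex. Delete vertices greedily, keeping the set S of surviving vertices and the
-- hypergraph H of edges that avoid every deleted vertex, with potential
-- Φ(H, S) = Σ_{v ∈ S} d_v f(deg_H v), where d_v is the degree in the original hypergraph.
-- Deleting a uniformly random non-isolated vertex u does not decrease Φ on average: for v ∈ S,
-- convexity gives f(deg v − codeg(u, v)) ≥ f(deg v) + codeg(u, v) (f(deg v − 1) − f(deg v)), and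
-- Σ_{u ≠ v} codeg(u, v) = p deg v, so the gain over u ≠ v pays exactly for losing v when u = v.
-- So some deletion does not decrease Φ; once no edge is left, S is independent and Φ = d(S).
-- Initially Φ = Σ_v d_v f(d_v), and d f(d) ≥ p/(p + 1) · d^((p − 1)/p) because
-- d f(d)^p ≥ (p/(p + 1))^p, which follows by induction on d from (1 + 1/x)^p ≤ x/(x − p).

module Submission where

open import Defs
open import Data.Nat.Base using (ℕ; zero; suc; _+_; _*_; _∸_; _^_; _≤_; _<_; z≤n; s≤s; z<s; NonZero; >-nonZero; >-nonZero⁻¹)
open import Data.Nat.Properties hiding (_≟_)
open import Algebra.Properties.Semiring.Sum +-*-semiring
  using (sum-syntax; sum-cong-≗; ∑-distrib-+; ∑-comm; *-distribˡ-sum; *-distribʳ-sum; sum-replicate-zero)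
import Data.Nat.ListAction as List
open import Data.Nat.Tactic.RingSolver using (solve-∀)
open import Data.Bool.Base using (true; false; if_then_else_)
open import Data.Fin.Base using (Fin; zero; suc)
open import Data.Fin.Properties using (_≟_; any?)
open import Data.Fin.Subset using (Subset; inside; outside; _∈_; _∉_; _⊆_; _-_; ⊤; ∣_∣; Nonempty)
open import Data.Fin.Subset.Properties using (_∈?_; ∈⊤; ⊆-trans; p─q⊆p; x∈p∧x≢y⇒x∈p-y)
open import Data.Vec.Base using ([]; _∷_; here; there)
open import Data.List.Base using (List; []; _∷_; length; filter; map; tabulate)
open import Data.List.Properties using (length-filter; filter-idem; filter-some)
open import Data.List.Relation.Unary.All as All using (All; []; _∷_)
import Data.List.Relation.Unary.All.Properties as Allₚ
import Data.List.Relation.Unary.Unique.Propositional.Properties as Uniqueₚ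
open import Data.List.Relation.Unary.Any using (here)
open import Data.List.Membership.Propositional using (lose) renaming (_∈_ to _∈ₗ_)
open import Data.List.Membership.Propositional.Properties using (∈-filter⁺)
open import Data.Product using (Σ; ∃-syntax; _×_; _,_)
open import Data.Sum using (inj₁; inj₂)
open import Function.Base using (_∘_; id)
open import Induction.WellFounded using (Acc; acc)
open import Data.Nat.Induction using (<-wellFounded)
open import Relation.Binary.PropositionalEquality
open import Relation.Nullary using (Dec; yes; no; does; ¬?; _×-dec_; contradiction)
open import Relation.Nullary.Decidable using (dec-true)
open import Relation.Unary using (Pred; Decidable)
open import Relation.Unary.Properties using (∁?)

𝟙 : ∀ {a} {A : Set a} → Dec A → ℕ
𝟙 a? = if does a? then 1 else 0

𝟙-yes : ∀ {a} {A : Set a} (a? : Dec A) → A → 𝟙 a? ≡ 1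
𝟙-yes a? a rewrite dec-true a? a = refl

∑-mono-≤ : ∀ {n} {f g : Fin n → ℕ} → (∀ i → f i ≤ g i) → ∑[ i < n ] f i ≤ ∑[ i < n ] g i
∑-mono-≤ {zero}  f≤g = z≤n
∑-mono-≤ {suc n} f≤g = +-mono-≤ (f≤g zero) (∑-mono-≤ (f≤g ∘ suc))

∑-mono-< : ∀ {n} {f g : Fin n → ℕ} → (∀ i → f i ≤ g i) → ∀ j → f j < g j →
           ∑[ i < n ] f i < ∑[ i < n ] g i
∑-mono-< f≤g zero    fj<gj = +-mono-<-≤ fj<gj (∑-mono-≤ (f≤g ∘ suc))
∑-mono-< f≤g (suc j) fj<gj = +-mono-≤-< (f≤g zero) (∑-mono-< (f≤g ∘ suc) j fj<gj)

∑-δ : ∀ {n} (j : Fin n) x → ∑[ i < n ] (𝟙 (i ≟ j) * x) ≡ x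
∑-δ {suc n} zero    x = trans (cong₂ _+_ (+-identityʳ x) (sum-replicate-zero n)) (+-identityʳ x)
∑-δ {suc n} (suc j) x = ∑-δ j x

∃-above-average : ∀ {n p} {P : Pred (Fin n) p} (P? : Decidable P) (A : Fin n → ℕ) B j → P j →
                  ∑[ i < n ] (𝟙 (P? i) * B) ≤ ∑[ i < n ] (𝟙 (P? i) * A i) → ∃[ i ] (P i × B ≤ A i)
∃-above-average {P = P} P? A B j Pj average with any? (λ i → P? i ×-dec B ≤? A i)
... | yes found = found
... | no  none  = contradiction average (<⇒≱ (∑-mono-< below j (strictly-below Pj)))
  where
  A<B : ∀ {i} → P i → A i < B
  A<B {i} Pi = ≰⇒> (λ B≤Ai → none (i , Pi , B≤Ai))
  below : ∀ i → 𝟙 (P? i) * A i ≤ 𝟙 (P? i) * B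
  below i with P? i
  ... | yes Pi = *-monoʳ-≤ 1 (<⇒≤ (A<B Pi))
  ... | no  _  = z≤n
  strictly-below : P j → 𝟙 (P? j) * A j < 𝟙 (P? j) * B
  strictly-below Pj with P? j
  ... | yes Pj′ = *-monoʳ-< 1 (A<B Pj′)
  ... | no ¬Pj  = contradiction Pj ¬Pj

∑-filter-tabulate : ∀ {a p n} {A : Set a} {P : Pred A p} (P? : Decidable P) (f : A → ℕ) (σ : Fin n → A) →
                    List.sum (map f (filter P? (tabulate σ))) ≡ ∑[ i < n ] (𝟙 (P? (σ i)) * f (σ i))
∑-filter-tabulate {n = zero}  P? f σ = refl
∑-filter-tabulate {n = suc n} P? f σ with does (P? (σ zero))
... | true  = cong₂ _+_ (sym (+-identityʳ _)) (∑-filter-tabulate P? f (σ ∘ suc))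
... | false = ∑-filter-tabulate P? f (σ ∘ suc)

module _ {a p} {A : Set a} {P : Pred A p} (P? : Decidable P) where

  length-filter-∷ : ∀ x xs → length (filter P? (x ∷ xs)) ≡ 𝟙 (P? x) + length (filter P? xs)
  length-filter-∷ x xs with does (P? x)
  ... | true  = refl
  ... | false = refl

  length-filter-∁ : ∀ xs → length (filter (∁? P?) xs) + length (filter P? xs) ≡ length xs
  length-filter-∁ []       = refl
  length-filter-∁ (x ∷ xs) with does (P? x)
  ... | true  = trans (+-suc _ _) (cong suc (length-filter-∁ xs))
  ... | false = cong suc (length-filter-∁ xs)

module _ {a p q} {A : Set a} {P : Pred A p} {Q : Pred A q} (P? : Decidable P) (Q? : Decidable Q) where

  length-filter-split : ∀ xs → length (filter Q? (filter (∁? P?) xs)) + length (filter Q? (filter P? xs))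
                               ≡ length (filter Q? xs)
  length-filter-split []       = refl
  length-filter-split (x ∷ xs) with does (P? x)
  ... | true  with does (Q? x)
  ...   | true  = trans (+-suc _ _) (cong suc (length-filter-split xs))
  ...   | false = length-filter-split xs
  length-filter-split (x ∷ xs) | false with does (Q? x)
  ...   | true  = cong suc (length-filter-split xs)
  ...   | false = length-filter-split xs

  length-filter-filter-∷ : ∀ x xs → length (filter Q? (filter P? (x ∷ xs)))
                                    ≡ 𝟙 (P? x) * 𝟙 (Q? x) + length (filter Q? (filter P? xs))
  length-filter-filter-∷ x xs with does (P? x)
  ... | false = refl
  ... | true  with does (Q? x)
  ...   | true  = refl
  ...   | false = refl

x∉p-x : ∀ {n} (p : Subset n) x → x ∉ p - x
x∉p-x (inside  ∷ p) zero    ()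
x∉p-x (outside ∷ p) zero    ()
x∉p-x (_       ∷ p) (suc x) (there x∈p-x) = x∉p-x p x x∈p-x

∣p∣≡∑𝟙∈ : ∀ {n} (p : Subset n) → ∣ p ∣ ≡ ∑[ i < n ] 𝟙 (i ∈? p)
∣p∣≡∑𝟙∈ []            = refl
∣p∣≡∑𝟙∈ (inside  ∷ p) = cong suc (∣p∣≡∑𝟙∈ p)
∣p∣≡∑𝟙∈ (outside ∷ p) = ∣p∣≡∑𝟙∈ p

∣p∣>0⇒Nonempty : ∀ {n} (p : Subset n) → 0 < ∣ p ∣ → Nonempty p
∣p∣>0⇒Nonempty (inside  ∷ p) _ = zero , here
∣p∣>0⇒Nonempty (outside ∷ p) ∣p∣>0 with ∣p∣>0⇒Nonempty p ∣p∣>0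
... | x , x∈p = suc x , there x∈p

𝟙[y∈p]*𝟙[x≢y]≤𝟙[y∈p-x] : ∀ {n} (p : Subset n) x y → 𝟙 (y ∈? p) * 𝟙 (¬? (x ≟ y)) ≤ 𝟙 (y ∈? p - x)
𝟙[y∈p]*𝟙[x≢y]≤𝟙[y∈p-x] p x y with y ∈? p | x ≟ y
... | no  _   | _      = z≤n
... | yes _   | yes _  = z≤n
... | yes y∈p | no x≢y = ≤-reflexive (sym (𝟙-yes (y ∈? p - x) (x∈p∧x≢y⇒x∈p-y y∈p (x≢y ∘ sym))))

module _ {m : ℕ} where

  size : Hypergraph m → ℕ
  size H = length (edges H)

  isolate : Fin m → Hypergraph m → Hypergraph m
  isolate u H = record
    { edges  = filter (∁? (u ∈?_)) (edges H)
    ; simple = Uniqueₚ.filter⁺ (∁? (u ∈?_)) (simple H)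
    }

  codegree : Hypergraph m → Fin m → Fin m → ℕ
  codegree H u v = length (filter (v ∈?_) (filter (u ∈?_) (edges H)))

  degree≤size : ∀ H v → degree H v ≤ size H
  degree≤size H v = length-filter (v ∈?_) (edges H)

  size-isolate : ∀ H u → size (isolate u H) + degree H u ≡ size H
  size-isolate H u = length-filter-∁ (u ∈?_) (edges H)

  size-isolate-< : ∀ H {u} → 0 < degree H u → size (isolate u H) < size H
  size-isolate-< H {u} degree>0 = subst (size (isolate u H) <_) (size-isolate H u) (m<m+n _ degree>0)

  ∈edge⇒degree>0 : ∀ (H : Hypergraph m) {e u} → e ∈ₗ edges H → u ∈ e → 0 < degree H u
  ∈edge⇒degree>0 H {u = u} e∈H u∈e = filter-some (u ∈?_) (lose {P = u ∈_} e∈H u∈e)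

  degree-isolate : ∀ H u v → degree (isolate u H) v + codegree H u v ≡ degree H v
  degree-isolate H u v = length-filter-split (u ∈?_) (v ∈?_) (edges H)

  codegree≤degree : ∀ H u v → codegree H u v ≤ degree H u
  codegree≤degree H u v = length-filter (v ∈?_) (filter (u ∈?_) (edges H))

  codegree-diag : ∀ H v → codegree H v v ≡ degree H v
  codegree-diag H v = cong length (filter-idem (v ∈?_) (edges H))

  ∑-codegree : ∀ {n} H → Uniform n H → ∀ v → ∑[ u < m ] codegree H u v ≡ n * degree H v
  ∑-codegree {n} H uniform v = double-count (edges H) uniform
    where
    deg : List (Subset m) → ℕ
    deg E = length (filter (v ∈?_) E)
    codeg : List (Subset m) → Fin m → ℕ
    codeg E u = length (filter (v ∈?_) (filter (u ∈?_) E))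
    double-count : ∀ E → All (λ e → ∣ e ∣ ≡ n) E → ∑[ u < m ] codeg E u ≡ n * deg E
    double-count []      []                   = trans (sum-replicate-zero m) (sym (*-zeroʳ n))
    double-count (e ∷ E) (∣e∣≡n ∷ uniformE) = begin
      ∑[ u < m ] codeg (e ∷ E) u
        ≡⟨ sum-cong-≗ (λ u → length-filter-filter-∷ (u ∈?_) (v ∈?_) e E) ⟩
      ∑[ u < m ] (𝟙 (u ∈? e) * 𝟙 (v ∈? e) + codeg E u)
        ≡⟨ ∑-distrib-+ (λ u → 𝟙 (u ∈? e) * 𝟙 (v ∈? e)) (codeg E) ⟩
      ∑[ u < m ] (𝟙 (u ∈? e) * 𝟙 (v ∈? e)) + ∑[ u < m ] codeg E u
        ≡⟨ cong₂ _+_ (sym (*-distribʳ-sum (𝟙 (v ∈? e)) (λ u → 𝟙 (u ∈? e)))) (double-count E uniformE) ⟩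
      (∑[ u < m ] 𝟙 (u ∈? e)) * 𝟙 (v ∈? e) + n * deg E
        ≡⟨ cong (λ k → k * 𝟙 (v ∈? e) + n * deg E) (trans (sym (∣p∣≡∑𝟙∈ e)) ∣e∣≡n) ⟩
      n * 𝟙 (v ∈? e) + n * deg E
        ≡⟨ *-distribˡ-+ n _ _ ⟨
      n * (𝟙 (v ∈? e) + deg E)
        ≡⟨ cong (n *_) (length-filter-∷ (v ∈?_) e E) ⟨
      n * deg (e ∷ E) ∎
      where open ≡-Reasoning

  isolate-uniform : ∀ {n} H u → Uniform n H → Uniform n (isolate u H)
  isolate-uniform H u = Allₚ.filter⁺ (∁? (u ∈?_))

  isolate-independent : ∀ H {u I} → u ∉ I → Independent (isolate u H) I → Independent H I
  isolate-independent H {u} u∉I independent e e∈H e⊆I with u ∈? e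
  ... | yes u∈e = u∉I (e⊆I u∈e)
  ... | no  u∉e = independent e (∈-filter⁺ (∁? (u ∈?_)) e∈H u∉e) e⊆I

^-distribʳ-* : ∀ a b k → (a * b) ^ k ≡ a ^ k * b ^ k
^-distribʳ-* a b zero    = refl
^-distribʳ-* a b (suc k) = begin
  a * b * (a * b) ^ k        ≡⟨ cong (a * b *_) (^-distribʳ-* a b k) ⟩
  a * b * (a ^ k * b ^ k)    ≡⟨ interchange a b (a ^ k) (b ^ k) ⟩
  a * a ^ k * (b * b ^ k)    ∎
  where
  open ≡-Reasoning
  interchange : ∀ w x y z → w * x * (y * z) ≡ w * y * (x * z)
  interchange = solve-∀

^-cancelʳ-≤ : ∀ k .{{_ : NonZero k}} {x y} → x ^ k ≤ y ^ k → x ≤ y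
^-cancelʳ-≤ k {x} {y} xᵏ≤yᵏ with x ≤? y
... | yes x≤y = x≤y
... | no  x≰y = contradiction xᵏ≤yᵏ (<⇒≱ (^-monoˡ-< k (≰⇒> x≰y)))

y*[1+x]^k≤x^[1+k] : ∀ k {x} y → y + k ≡ x → y * suc x ^ k ≤ x ^ suc k
y*[1+x]^k≤x^[1+k] zero    y refl = ≤-reflexive (cong (_* 1) (sym (+-identityʳ y)))
y*[1+x]^k≤x^[1+k] (suc k) {x} y y+1+k≡x = begin
  y * (suc x * suc x ^ k)    ≡⟨ *-assoc y (suc x) _ ⟨
  y * suc x * suc x ^ k      ≤⟨ *-monoˡ-≤ (suc x ^ k) y[1+x]≤x[1+y] ⟩
  x * suc y * suc x ^ k      ≡⟨ *-assoc x (suc y) _ ⟩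
  x * (suc y * suc x ^ k)    ≤⟨ *-monoʳ-≤ x (y*[1+x]^k≤x^[1+k] k (suc y) (trans (sym (+-suc y k)) y+1+k≡x)) ⟩
  x * x ^ suc k              ∎
  where
  open ≤-Reasoning
  y≤x : y ≤ x
  y≤x = subst (y ≤_) y+1+k≡x (m≤m+n y (suc k))
  y[1+x]≤x[1+y] : y * suc x ≤ x * suc y
  y[1+x]≤x[1+y] = begin
    y * suc x    ≡⟨ *-suc y x ⟩
    y + y * x    ≤⟨ +-monoˡ-≤ (y * x) y≤x ⟩
    x + y * x    ≡⟨ cong (x +_) (*-comm y x) ⟩
    x + x * y    ≡⟨ *-suc x y ⟨
    x * suc y    ∎

-- The weight f is scaled by K = ∏_{i=1}^{M} (p i + 1) to stay in ℕ: for d ≤ M,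
-- B d = ∏_{i ≤ d} p i, A d = ∏_{i ≤ d} (p i + 1), C k d = ∏_{d < i ≤ d + k} (p i + 1),
-- g d = K f(d) = B d · C (M ∸ d) d, and Δ d = g d − g (d + 1) when d < M.
module CaroTuzaWeight (p M : ℕ) where

  B : ℕ → ℕ
  B zero    = 1
  B (suc d) = B d * (p * suc d)

  A : ℕ → ℕ
  A zero    = 1
  A (suc d) = A d * suc (p * suc d)

  C : ℕ → ℕ → ℕ
  C zero    d = 1
  C (suc k) d = suc (p * suc d) * C k (suc d)

  g : ℕ → ℕ
  g d = B d * C (M ∸ d) d

  Δ : ℕ → ℕ
  Δ d = B d * C (M ∸ suc d) (suc d)

  K : ℕ
  K = C M 0

  C-positive : ∀ k d → 0 < C k d
  C-positive zero    d = z<s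
  C-positive (suc k) d = *-mono-≤ (s≤s (z≤n {p * suc d})) (C-positive k (suc d))

  K-nonZero : NonZero K
  K-nonZero = >-nonZero (C-positive M 0)

  C-unfold : ∀ {d} → d < M → C (M ∸ d) d ≡ suc (p * suc d) * C (M ∸ suc d) (suc d)
  C-unfold {d} d<M = cong (λ k → C k d) (+-∸-assoc 1 d<M)

  g-zero : g 0 ≡ K
  g-zero = *-identityˡ K

  g-suc : ∀ d → g (suc d) ≡ p * suc d * Δ d
  g-suc d = lemma (B d) (p * suc d) (C (M ∸ suc d) (suc d))
    where
    lemma : ∀ b x c → b * x * c ≡ x * (b * c)
    lemma = solve-∀

  g-step : ∀ {d} → d < M → g d ≡ g (suc d) + Δ d
  g-step {d} d<M = trans (cong (B d *_) (C-unfold d<M)) (lemma (B d) (p * suc d) (C (M ∸ suc d) (suc d)))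
    where
    lemma : ∀ b x c → b * (suc x * c) ≡ b * x * c + b * c
    lemma = solve-∀

  Δ-suc≤Δ : ∀ {d} → suc d < M → Δ (suc d) ≤ Δ d
  Δ-suc≤Δ {d} 1+d<M = begin
    B d * (p * suc d) * c          ≡⟨ *-assoc (B d) _ c ⟩
    B d * (p * suc d * c)          ≤⟨ *-monoʳ-≤ (B d) (*-monoˡ-≤ c p[1+d]≤1+p[2+d]) ⟩
    B d * (suc (p * suc (suc d)) * c) ≡⟨ cong (B d *_) (C-unfold 1+d<M) ⟨
    Δ d                            ∎
    where
    open ≤-Reasoning
    c : ℕ
    c = C (M ∸ suc (suc d)) (suc (suc d))
    p[1+d]≤1+p[2+d] : p * suc d ≤ suc (p * suc (suc d))
    p[1+d]≤1+p[2+d] = m≤n⇒m≤1+n (*-monoʳ-≤ p (n≤1+n (suc d)))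

  Δ-antitone : ∀ {x d} → x ≤ d → d < M → Δ d ≤ Δ x
  Δ-antitone {d = zero}  z≤n    _ = ≤-refl
  Δ-antitone {d = suc d} x≤1+d 1+d<M with m≤n⇒m<n∨m≡n x≤1+d
  ... | inj₂ refl       = ≤-refl
  ... | inj₁ (s≤s x≤d) = ≤-trans (Δ-suc≤Δ 1+d<M) (Δ-antitone x≤d (<-trans (n<1+n d) 1+d<M))

  g-chord : ∀ c {x d} → x + c ≡ suc d → suc d ≤ M → g (suc d) + c * Δ d ≤ g x
  g-chord zero    {x} x+0≡1+d _ rewrite +-identityʳ x | x+0≡1+d = ≤-reflexive (+-identityʳ _)
  g-chord (suc c) {x} {d} x+1+c≡1+d 1+d≤M = begin
    g (suc d) + (Δ d + c * Δ d)    ≡⟨ lemma (g (suc d)) (Δ d) (c * Δ d) ⟩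
    g (suc d) + c * Δ d + Δ d      ≤⟨ +-mono-≤ (g-chord c x+c≡d′ 1+d≤M) (Δ-antitone x≤d 1+d≤M) ⟩
    g (suc x) + Δ x                ≡⟨ g-step (≤-trans (s≤s x≤d) 1+d≤M) ⟨
    g x                            ∎
    where
    open ≤-Reasoning
    lemma : ∀ a b c → a + (b + c) ≡ a + c + b
    lemma = solve-∀
    x+c≡d′ : suc x + c ≡ suc d
    x+c≡d′ = trans (sym (+-suc x c)) x+1+c≡1+d
    x≤d : x ≤ d
    x≤d = subst (x ≤_) (suc-injective x+c≡d′) (m≤m+n x c)

  K≡A*C : ∀ {d} → d ≤ M → K ≡ A d * C (M ∸ d) d
  K≡A*C {zero}  _     = sym (*-identityˡ K)
  K≡A*C {suc d} 1+d≤M = begin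
    K                                               ≡⟨ K≡A*C (≤-trans (n≤1+n d) 1+d≤M) ⟩
    A d * C (M ∸ d) d                               ≡⟨ cong (A d *_) (C-unfold 1+d≤M) ⟩
    A d * (suc (p * suc d) * C (M ∸ suc d) (suc d)) ≡⟨ *-assoc (A d) _ _ ⟨
    A (suc d) * C (M ∸ suc d) (suc d)               ∎
    where open ≡-Reasoning

  A-B-step : .{{_ : NonZero p}} → ∀ D → D * suc (p * suc D) ^ p ≤ suc D * (p * suc D) ^ p
  A-B-step D = *-cancelˡ-≤ p (begin
    p * (D * suc x ^ p)    ≡⟨ *-assoc p D _ ⟨
    p * D * suc x ^ p      ≤⟨ y*[1+x]^k≤x^[1+k] p (p * D) pD+p≡x ⟩
    x * x ^ p              ≡⟨ *-assoc p (suc D) _ ⟩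
    p * (suc D * x ^ p)    ∎)
    where
    open ≤-Reasoning
    x : ℕ
    x = p * suc D
    pD+p≡x : p * D + p ≡ x
    pD+p≡x = trans (+-comm (p * D) p) (sym (*-suc p D))

  A-B-bound : .{{_ : NonZero p}} → ∀ d → (p * A (suc d)) ^ p ≤ suc d * (suc p * B (suc d)) ^ p
  A-B-bound zero    = ≤-reflexive (trans (cong (_^ p) (lemma p)) (sym (*-identityˡ _)))
    where
    lemma : ∀ p → p * (1 * suc (p * 1)) ≡ suc p * (1 * (p * 1))
    lemma = solve-∀
  A-B-bound (suc d) = begin
    (p * (a * suc x)) ^ p                ≡⟨ cong (_^ p) (*-assoc p a (suc x)) ⟨
    (p * a * suc x) ^ p                  ≡⟨ ^-distribʳ-* (p * a) (suc x) p ⟩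
    (p * a) ^ p * suc x ^ p              ≤⟨ *-monoˡ-≤ (suc x ^ p) (A-B-bound d) ⟩
    suc d * N ^ p * suc x ^ p            ≡⟨ lemma₁ (suc d) (N ^ p) (suc x ^ p) ⟩
    N ^ p * (suc d * suc x ^ p)          ≤⟨ *-monoʳ-≤ (N ^ p) (A-B-step (suc d)) ⟩
    N ^ p * (suc (suc d) * x ^ p)        ≡⟨ lemma₂ (suc (suc d)) (N ^ p) (x ^ p) ⟩
    suc (suc d) * (N ^ p * x ^ p)        ≡⟨ cong (suc (suc d) *_) (^-distribʳ-* N x p) ⟨
    suc (suc d) * (N * x) ^ p            ≡⟨ cong (λ y → suc (suc d) * y ^ p) (*-assoc (suc p) b x) ⟩
    suc (suc d) * (suc p * (b * x)) ^ p  ∎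
    where
    open ≤-Reasoning
    a : ℕ
    a = A (suc d)
    b : ℕ
    b = B (suc d)
    x : ℕ
    x = p * suc (suc d)
    N : ℕ
    N = suc p * b
    lemma₁ : ∀ s y z → s * y * z ≡ y * (s * z)
    lemma₁ = solve-∀
    lemma₂ : ∀ s y z → y * (s * z) ≡ s * (y * z)
    lemma₂ = solve-∀

  d*g[d]-bound : .{{_ : NonZero p}} → ∀ {d} a b → a ^ p ≤ suc d ^ (p ∸ 1) * b ^ p → suc d ≤ M →
                 p * a * K ≤ suc p * b * (suc d * g (suc d))
  d*g[d]-bound {d} a b aᵖ≤dᵖ⁻¹bᵖ 1+d≤M = begin
    p * a * K                    ≡⟨ cong (p * a *_) (K≡A*C 1+d≤M) ⟩
    p * a * (A D * c)            ≡⟨ *-assoc (p * a) (A D) c ⟨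
    p * a * A D * c              ≤⟨ *-monoˡ-≤ c (^-cancelʳ-≤ p powers) ⟩
    suc p * b * D * B D * c      ≡⟨ lemma (suc p * b) D (B D) c ⟩
    suc p * b * (D * (B D * c))  ∎
    where
    open ≤-Reasoning
    D : ℕ
    D = suc d
    c : ℕ
    c = C (M ∸ D) D
    lemma : ∀ x y z w → x * y * z * w ≡ x * (y * (z * w))
    lemma = solve-∀
    Dᵖ : D * D ^ (p ∸ 1) ≡ D ^ p
    Dᵖ = cong (D ^_) (m+[n∸m]≡n (>-nonZero⁻¹ p))
    powers : (p * a * A D) ^ p ≤ (suc p * b * D * B D) ^ p
    powers = begin
      (p * a * A D) ^ p                                ≡⟨ cong (_^ p) (lemma₁ p a (A D)) ⟩
      (a * (p * A D)) ^ p                              ≡⟨ ^-distribʳ-* a (p * A D) p ⟩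
      a ^ p * (p * A D) ^ p                            ≤⟨ *-mono-≤ aᵖ≤dᵖ⁻¹bᵖ (A-B-bound d) ⟩
      D ^ (p ∸ 1) * b ^ p * (D * (suc p * B D) ^ p)    ≡⟨ lemma₂ (D ^ (p ∸ 1)) (b ^ p) D _ ⟩
      D * D ^ (p ∸ 1) * (b ^ p * (suc p * B D) ^ p)    ≡⟨ cong₂ _*_ Dᵖ (sym (^-distribʳ-* b (suc p * B D) p)) ⟩
      D ^ p * (b * (suc p * B D)) ^ p                  ≡⟨ ^-distribʳ-* D (b * (suc p * B D)) p ⟨
      (D * (b * (suc p * B D))) ^ p                    ≡⟨ cong (_^ p) (lemma₃ D b (suc p) (B D)) ⟩
      (suc p * b * D * B D) ^ p                        ∎
      where
      lemma₁ : ∀ p a x → p * a * x ≡ a * (p * x)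
      lemma₁ = solve-∀
      lemma₂ : ∀ u v w z → u * v * (w * z) ≡ w * u * (v * z)
      lemma₂ = solve-∀
      lemma₃ : ∀ u v w z → u * (v * (w * z)) ≡ w * v * u * z
      lemma₃ = solve-∀

  ∑-d*g[d]-bound : .{{_ : NonZero p}} → ∀ {m} (d a : Fin m → ℕ) b →
                   (∀ v → a v ^ p ≤ d v ^ (p ∸ 1) * b ^ p) → (∀ v → d v ≤ M) →
                   p * (∑[ v < m ] (𝟙 (0 <? d v) * a v)) * K ≤ suc p * b * (∑[ v < m ] (d v * g (d v)))
  ∑-d*g[d]-bound {m} d a b aᵖ≤dᵖ⁻¹bᵖ d≤M = begin
    p * (∑[ v < m ] (𝟙 (0 <? d v) * a v)) * K    ≡⟨ cong (_* K) (*-distribˡ-sum p (λ v → 𝟙 (0 <? d v) * a v)) ⟩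
    (∑[ v < m ] (p * (𝟙 (0 <? d v) * a v))) * K  ≡⟨ *-distribʳ-sum K (λ v → p * (𝟙 (0 <? d v) * a v)) ⟩
    ∑[ v < m ] (p * (𝟙 (0 <? d v) * a v) * K)    ≤⟨ ∑-mono-≤ bound ⟩
    ∑[ v < m ] (suc p * b * (d v * g (d v)))     ≡⟨ *-distribˡ-sum (suc p * b) (λ v → d v * g (d v)) ⟨
    suc p * b * (∑[ v < m ] (d v * g (d v)))     ∎
    where
    open ≤-Reasoning
    bound : ∀ v → p * (𝟙 (0 <? d v) * a v) * K ≤ suc p * b * (d v * g (d v))
    bound v with d v | aᵖ≤dᵖ⁻¹bᵖ v | d≤M v
    ... | zero  | _    | _    = ≤-trans (≤-reflexive (cong (_* K) (*-zeroʳ p))) z≤n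
    ... | suc _ | aᵖ≤ | d≤M′ = subst (λ x → p * x * K ≤ _) (sym (*-identityˡ (a v))) (d*g[d]-bound (a v) b aᵖ≤ d≤M′)

module Greedy {m : ℕ} (p M : ℕ) (W : Fin m → ℕ) where

  open CaroTuzaWeight p M

  Φ : Hypergraph m → Subset m → ℕ
  Φ H S = ∑[ v < m ] (𝟙 (v ∈? S) * (W v * g (degree H v)))

  weight : Subset m → ℕ
  weight S = ∑[ v < m ] (𝟙 (v ∈? S) * W v)

  g-after-isolated : ∀ (H : Hypergraph m) {v} → degree H v ≡ 0 → ∀ u →
    𝟙 (0 <? degree H u) * g 0 ≤ 𝟙 (0 <? degree H u) * (𝟙 (¬? (u ≟ v)) * g (degree (isolate u H) v))
  g-after-isolated H {v} dᵥ≡0 u with degree H u in dᵤ≡ | u ≟ v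
  ... | zero  | _        = z≤n
  ... | suc _ | yes refl = contradiction (trans (sym dᵤ≡) dᵥ≡0) λ ()
  ... | suc _ | no  _    = *-monoʳ-≤ 1 (≤-reflexive (sym (trans (*-identityˡ _) (cong g d′≡0))))
    where
    d′≡0 : degree (isolate u H) v ≡ 0
    d′≡0 = m+n≡0⇒m≡0 _ (trans (degree-isolate H u v) dᵥ≡0)

  g-after-nonisolated : ∀ (H : Hypergraph m) {v D} → size H ≤ M → degree H v ≡ suc D → ∀ u →
    𝟙 (0 <? degree H u) * g (suc D) + codegree H u v * Δ D
      ≤ 𝟙 (0 <? degree H u) * (𝟙 (¬? (u ≟ v)) * g (degree (isolate u H) v)) + 𝟙 (u ≟ v) * (suc p * suc D * Δ D)
  g-after-nonisolated H {v} {D} H≤M dᵥ≡1+D u with u ≟ v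
  ... | yes refl rewrite codegree-diag H u | dᵥ≡1+D | g-suc D = ≤-reflexive (lemma p D (Δ D))
    where
    lemma : ∀ p D δ → 1 * (p * suc D * δ) + suc D * δ ≡ 1 * (suc p * suc D * δ)
    lemma = solve-∀
  ... | no _ with degree H u in dᵤ≡
  ...   | zero rewrite n≤0⇒n≡0 (subst (codegree H u v ≤_) dᵤ≡ (codegree≤degree H u v)) = z≤n
  ...   | suc _ = begin
    1 * g (suc D) + codegree H u v * Δ D      ≡⟨ cong (_+ codegree H u v * Δ D) (*-identityˡ _) ⟩
    g (suc D) + codegree H u v * Δ D          ≤⟨ g-chord (codegree H u v) (trans (degree-isolate H u v) dᵥ≡1+D) 1+D≤M ⟩
    g (degree (isolate u H) v)                ≡⟨ trans (*-identityˡ _) (*-identityˡ _) ⟨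
    1 * (1 * g (degree (isolate u H) v))      ≡⟨ +-identityʳ _ ⟨
    1 * (1 * g (degree (isolate u H) v)) + 0  ∎
    where
    open ≤-Reasoning
    1+D≤M : suc D ≤ M
    1+D≤M = subst (_≤ M) dᵥ≡1+D (≤-trans (degree≤size H v) H≤M)

  g-average : ∀ H → size H ≤ M → Uniform (suc p) H → ∀ v →
    (∑[ u < m ] 𝟙 (0 <? degree H u)) * g (degree H v)
      ≤ ∑[ u < m ] (𝟙 (0 <? degree H u) * (𝟙 (¬? (u ≟ v)) * g (degree (isolate u H) v)))
  g-average H H≤M uniform v with degree H v in dᵥ≡
  ... | zero = begin
    (∑[ u < m ] t u) * g 0          ≡⟨ *-distribʳ-sum (g 0) t ⟩
    ∑[ u < m ] (t u * g 0)          ≤⟨ ∑-mono-≤ (g-after-isolated H {v} dᵥ≡) ⟩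
    ∑[ u < m ] (t u * after u)      ∎
    where
    open ≤-Reasoning
    t : Fin m → ℕ
    t u = 𝟙 (0 <? degree H u)
    after : Fin m → ℕ
    after u = 𝟙 (¬? (u ≟ v)) * g (degree (isolate u H) v)
  ... | suc D = +-cancelʳ-≤ X _ _ (begin
    (∑[ u < m ] t u) * g (suc D) + X
      ≡⟨ cong₂ _+_ (*-distribʳ-sum (g (suc D)) t) X≡∑codegree ⟩
    ∑[ u < m ] (t u * g (suc D)) + ∑[ u < m ] (codegree H u v * Δ D)
      ≡⟨ ∑-distrib-+ (λ u → t u * g (suc D)) (λ u → codegree H u v * Δ D) ⟨
    ∑[ u < m ] (t u * g (suc D) + codegree H u v * Δ D)
      ≤⟨ ∑-mono-≤ (g-after-nonisolated H {v} H≤M dᵥ≡) ⟩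
    ∑[ u < m ] (t u * after u + 𝟙 (u ≟ v) * X)
      ≡⟨ ∑-distrib-+ (λ u → t u * after u) (λ u → 𝟙 (u ≟ v) * X) ⟩
    ∑[ u < m ] (t u * after u) + ∑[ u < m ] (𝟙 (u ≟ v) * X)
      ≡⟨ cong (∑[ u < m ] (t u * after u) +_) (∑-δ v X) ⟩
    ∑[ u < m ] (t u * after u) + X  ∎)
    where
    open ≤-Reasoning
    t : Fin m → ℕ
    t u = 𝟙 (0 <? degree H u)
    after : Fin m → ℕ
    after u = 𝟙 (¬? (u ≟ v)) * g (degree (isolate u H) v)
    X : ℕ
    X = suc p * suc D * Δ D
    X≡∑codegree : X ≡ ∑[ u < m ] (codegree H u v * Δ D)
    X≡∑codegree = begin-equality
      suc p * suc D * Δ D                ≡⟨ cong (λ d → suc p * d * Δ D) dᵥ≡ ⟨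
      suc p * degree H v * Δ D           ≡⟨ cong (_* Δ D) (∑-codegree H uniform v) ⟨
      (∑[ u < m ] codegree H u v) * Δ D  ≡⟨ *-distribʳ-sum (Δ D) (λ u → codegree H u v) ⟩
      ∑[ u < m ] (codegree H u v * Δ D)  ∎

  Φ-average-at : ∀ H S → size H ≤ M → Uniform (suc p) H → ∀ v →
    (∑[ u < m ] 𝟙 (0 <? degree H u)) * (𝟙 (v ∈? S) * (W v * g (degree H v)))
      ≤ ∑[ u < m ] (𝟙 (0 <? degree H u) * (𝟙 (v ∈? S - u) * (W v * g (degree (isolate u H) v))))
  Φ-average-at H S H≤M uniform v = begin
    T * (s * (W v * g (degree H v)))                ≡⟨ lemma T s (W v) _ ⟩
    s * W v * (T * g (degree H v))                  ≤⟨ *-monoʳ-≤ (s * W v) (g-average H H≤M uniform v) ⟩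
    s * W v * ∑[ u < m ] (t u * (e u * G u))        ≡⟨ *-distribˡ-sum (s * W v) (λ u → t u * (e u * G u)) ⟩
    ∑[ u < m ] (s * W v * (t u * (e u * G u)))      ≤⟨ ∑-mono-≤ survive ⟩
    ∑[ u < m ] (t u * (𝟙 (v ∈? S - u) * (W v * G u))) ∎
    where
    open ≤-Reasoning
    t : Fin m → ℕ
    t u = 𝟙 (0 <? degree H u)
    T : ℕ
    T = ∑[ u < m ] t u
    s : ℕ
    s = 𝟙 (v ∈? S)
    e : Fin m → ℕ
    e u = 𝟙 (¬? (u ≟ v))
    G : Fin m → ℕ
    G u = g (degree (isolate u H) v)
    lemma : ∀ T s w x → T * (s * (w * x)) ≡ s * w * (T * x)
    lemma = solve-∀
    regroup : ∀ s w t e x → s * w * (t * (e * x)) ≡ t * (s * e * (w * x))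
    regroup = solve-∀
    survive : ∀ u → s * W v * (t u * (e u * G u)) ≤ t u * (𝟙 (v ∈? S - u) * (W v * G u))
    survive u = begin
      s * W v * (t u * (e u * G u))     ≡⟨ regroup s (W v) (t u) (e u) (G u) ⟩
      t u * (s * e u * (W v * G u))     ≤⟨ *-monoʳ-≤ (t u) (*-monoˡ-≤ (W v * G u) (𝟙[y∈p]*𝟙[x≢y]≤𝟙[y∈p-x] S u v)) ⟩
      t u * (𝟙 (v ∈? S - u) * (W v * G u)) ∎

  Φ-average : ∀ H S → size H ≤ M → Uniform (suc p) H →
    ∑[ u < m ] (𝟙 (0 <? degree H u) * Φ H S) ≤ ∑[ u < m ] (𝟙 (0 <? degree H u) * Φ (isolate u H) (S - u))
  Φ-average H S H≤M uniform = begin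
    ∑[ u < m ] (t u * Φ H S)                          ≡⟨ *-distribʳ-sum (Φ H S) t ⟨
    (∑[ u < m ] t u) * Φ H S                          ≡⟨ *-distribˡ-sum (∑[ u < m ] t u) φ ⟩
    ∑[ v < m ] ((∑[ u < m ] t u) * φ v)               ≤⟨ ∑-mono-≤ (Φ-average-at H S H≤M uniform) ⟩
    ∑[ v < m ] ∑[ u < m ] (t u * φ′ u v)              ≡⟨ ∑-comm (λ v u → t u * φ′ u v) ⟩
    ∑[ u < m ] ∑[ v < m ] (t u * φ′ u v)              ≡⟨ sum-cong-≗ (λ u → *-distribˡ-sum (t u) (φ′ u)) ⟨
    ∑[ u < m ] (t u * Φ (isolate u H) (S - u))        ∎
    where
    open ≤-Reasoning
    t : Fin m → ℕ
    t u = 𝟙 (0 <? degree H u)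
    φ : Fin m → ℕ
    φ v = 𝟙 (v ∈? S) * (W v * g (degree H v))
    φ′ : Fin m → Fin m → ℕ
    φ′ u v = 𝟙 (v ∈? S - u) * (W v * g (degree (isolate u H) v))

  Φ-step : ∀ H S → size H ≤ M → Uniform (suc p) H → ∀ {e} → e ∈ₗ edges H →
           ∃[ u ] (0 < degree H u × Φ H S ≤ Φ (isolate u H) (S - u))
  Φ-step H S H≤M uniform e∈H =
    let u , u∈e = ∣p∣>0⇒Nonempty _ (subst (0 <_) (sym (All.lookup uniform e∈H)) z<s)
    in ∃-above-average (λ u → 0 <? degree H u) (λ u → Φ (isolate u H) (S - u)) (Φ H S)
                       u (∈edge⇒degree>0 H e∈H u∈e) (Φ-average H S H≤M uniform)

  Φ-⊤ : ∀ H → Φ H ⊤ ≡ ∑[ v < m ] (W v * g (degree H v))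
  Φ-⊤ H = sum-cong-≗ (λ v → trans (cong (_* (W v * g (degree H v))) (𝟙-yes (v ∈? ⊤) ∈⊤))
                                   (*-identityˡ (W v * g (degree H v))))

  Φ-edgeless : ∀ H S → (∀ v → degree H v ≡ 0) → Φ H S ≡ K * weight S
  Φ-edgeless H S isolated = begin
    ∑[ v < m ] (𝟙 (v ∈? S) * (W v * g (degree H v)))  ≡⟨ sum-cong-≗ (λ v → cong (λ d → 𝟙 (v ∈? S) * (W v * g d)) (isolated v)) ⟩
    ∑[ v < m ] (𝟙 (v ∈? S) * (W v * g 0))            ≡⟨ sum-cong-≗ (λ v → lemma (𝟙 (v ∈? S)) (W v) (g 0)) ⟩
    ∑[ v < m ] (g 0 * (𝟙 (v ∈? S) * W v))            ≡⟨ *-distribˡ-sum (g 0) (λ v → 𝟙 (v ∈? S) * W v) ⟨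
    g 0 * weight S                                    ≡⟨ cong (_* weight S) g-zero ⟩
    K * weight S                                      ∎
    where
    open ≡-Reasoning
    lemma : ∀ s w x → s * (w * x) ≡ x * (s * w)
    lemma = solve-∀

  greedy : ∀ H S → Acc _<_ (size H) → size H ≤ M → Uniform (suc p) H →
           ∃[ I ] (I ⊆ S × Independent H I × Φ H S ≤ K * weight I)
  greedy H@record { edges = [] } S _ _ _ = S , id , (λ _ ()) , ≤-reflexive (Φ-edgeless H S (λ _ → refl))
  greedy H@record { edges = _ ∷ _ } S (acc smaller) H≤M uniform =
    let u , u-nonisolated , Φ≤ = Φ-step H S H≤M uniform (here refl)
        H-u<H = size-isolate-< H {u} u-nonisolated
        I , I⊆S-u , independent , bound = greedy (isolate u H) (S - u) (smaller H-u<H)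
                                                 (≤-trans (<⇒≤ H-u<H) H≤M) (isolate-uniform H u uniform)
    in I , ⊆-trans I⊆S-u (p─q⊆p S _)
         , isolate-independent H (λ u∈I → x∉p-x S u (I⊆S-u u∈I)) independent
         , ≤-trans Φ≤ bound

theorem2 : (n m : ℕ) → 2 ≤ n → (H : Hypergraph m) → Uniform n H →
    Σ (Subset m) λ I → Independent H I ×
      ((b : ℕ) → 1 ≤ b → (a : Fin m → ℕ) →
        (∀ v → a v ^ (n ∸ 1) ≤ degree H v ^ (n ∸ 2) * b ^ (n ∸ 1)) →
        (n ∸ 1) * sumPos H a ≤ n * b * degSum H I)
theorem2 (suc (suc q)) m (s≤s (s≤s z≤n)) H uniform
  with I , _ , independent , Φ⊤≤ ← Greedy.greedy (suc q) (size H) (degree H) H ⊤ (<-wellFounded (size H)) ≤-refl uniform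
  = I , independent , bound
  where
  open CaroTuzaWeight (suc q) (size H)
  open Greedy (suc q) (size H) (degree H)
  bound : ∀ b → 1 ≤ b → ∀ a → (∀ v → a v ^ suc q ≤ degree H v ^ q * b ^ suc q) →
          suc q * sumPos H a ≤ suc (suc q) * b * degSum H I
  bound b _ a aᵖ≤dᵖ⁻¹bᵖ = *-cancelʳ-≤ _ _ K {{K-nonZero}} (begin
    suc q * sumPos H a * K
      ≡⟨ cong (λ x → suc q * x * K) (∑-filter-tabulate (λ v → 0 <? degree H v) a id) ⟩
    suc q * (∑[ v < m ] (𝟙 (0 <? degree H v) * a v)) * K
      ≤⟨ ∑-d*g[d]-bound (degree H) a b aᵖ≤dᵖ⁻¹bᵖ (degree≤size H) ⟩
    suc (suc q) * b * (∑[ v < m ] (degree H v * g (degree H v)))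
      ≡⟨ cong (suc (suc q) * b *_) (Φ-⊤ H) ⟨
    suc (suc q) * b * Φ H ⊤
      ≤⟨ *-monoʳ-≤ (suc (suc q) * b) Φ⊤≤ ⟩
    suc (suc q) * b * (K * weight I)
      ≡⟨ cong (λ x → suc (suc q) * b * (K * x)) (∑-filter-tabulate (_∈? I) (degree H) id) ⟨
    suc (suc q) * b * (K * degSum H I)
      ≡⟨ lemma (suc (suc q) * b) K (degSum H I) ⟩
    suc (suc q) * b * degSum H I * K ∎)
    where
    open ≤-Reasoning
    lemma : ∀ x k y → x * (k * y) ≡ x * y * k
    lemma = solve-∀
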